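{- Let $\mathbf{F}$ be the free commutative groupoid on one generator, i.e., the quotient of the groupoid of all terms over the single variable $x_1$ (with operation $(s,t)\mapsto(st)$) by the congruence consisting of all pairs of terms $(s,t)$ such that the identity $s\approx t$ holds in every commutative groupoid. Then for every $n\in\mathbb{N}_+$, $s^{\mathrm{ac}}_n(\mathbf{F})=D_{n-1}$, where $D_m=(2m)!/(2^m m!)$.
   Context: A groupoid is a nonempty set $G$ with a binary operation $*$; it is commutative if $a*b=b*a$ for all $a,b$. For $X_n=\{x_1,\dots,x_n\}$, groupoid terms over $X_n$ are built recursively: each variable is a term, and if $s,t$ are terms then $(st)$ is a term. A full linear term over $X_n$ is a term in which each of $x_1,\dots,x_n$ occurs exactly once. Each term $t$ over $X_n$ induces an $n$-ary term operation $t^{\mathbf{G}}\colon G^n\to G$. The ac-spectrum $s^{\mathrm{ac}}_n(\mathbf{G})$ is the number of distinct term operations on $\mathbf{G}$ induced by full linear terms over $X_n$. -}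

module Defs where

open import Data.Nat using (ℕ; zero; suc; _+_; _*_; _^_; _/_; NonZero; _!)
open import Data.Nat.Properties using (_!≢0; m^n≢0; m*n≢0)
open import Data.Product using (Σ; _×_)
open import Data.Fin using (Fin)
open import Data.Fin.Properties using (_≟_)
open import Relation.Nullary using (yes; no)
open import Relation.Binary.PropositionalEquality using (_≡_)

data Term (n : ℕ) : Set where
  var : Fin n → Term n
  _·_ : Term n → Term n → Term n

infixl 7 _·_

occ : ∀ {n} → Fin n → Term n → ℕ
occ i (var j) with i ≟ j
... | yes _ = 1
... | no _  = 0
occ i (s · t) = occ i s + occ i t

FullLinear : ∀ {n} → Term n → Set
FullLinear {n} t = (i : Fin n) → occ i t ≡ 1

eval : ∀ {n} {G : Set} → (G → G → G) → (Fin n → G) → Term n → G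
eval _*_ a (var i) = a i
eval _*_ a (s · t) = eval _*_ a s * eval _*_ a t

-- The free commutative groupoid F on one generator x_1:
-- carrier = terms over X_1, operation = _·_, modulo the congruence _≈F_
-- of all pairs (s,t) such that s ≈ t holds in every commutative groupoid.
_≈F_ : Term 1 → Term 1 → Set₁
s ≈F t = (G : Set) (_*_ : G → G → G) → (∀ a b → a * b ≡ b * a) →
         (v : Fin 1 → G) → eval _*_ v s ≡ eval _*_ v t

-- substitution: term operation t^F applied to (representatives of) elements of F
subst : ∀ {n} → Term n → (Fin n → Term 1) → Term 1
subst t a = eval _·_ a t

SameOpF : ∀ {n} → Term n → Term n → Set₁
SameOpF {n} t t' = (a : Fin n → Term 1) → subst t a ≈F subst t' a

D : ℕ → ℕ
D m = ((2 * m) !) / (2 ^ m * m !)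
  where instance
    _ : NonZero (2 ^ m)
    _ = m^n≢0 2 m
    _ : NonZero (m !)
    _ = m !≢0
    _ : NonZero (2 ^ m * m !)
    _ = m*n≢0 (2 ^ m) (m !)

-- s^ac_n(F) = k : there are exactly k distinct term operations on F induced
-- by full linear terms over X_n, witnessed by an enumeration f of k full
-- linear terms inducing pairwise distinct operations, such that every full
-- linear term induces the same operation as one of them.
AcSpectrumF : ℕ → ℕ → Set₁
AcSpectrumF n k =
  Σ (Fin k → Term n) λ f →
    ((i : Fin k) → FullLinear (f i)) ×
    (((i j : Fin k) → SameOpF (f i) (f j) → i ≡ j) ×
     ((t : Term n) → FullLinear t → Σ (Fin k) λ i → SameOpF t (f i)))

-- Modulo commutativity every full linear term can be rotated into a unique sorted
-- term, in which the left factor of every product has the smaller leftmost variable.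
-- Distinct sorted terms induce distinct operations on F: substituting the powers
-- x₁², x₁³, … ∈ F and evaluating in the commutative groupoid (ℕ, ◇), where a ◇ b
-- encodes the unordered pair {a, b} injectively, recovers the sorted term.  A sorted
-- full linear term over X_{m+2} arises in exactly one way from one over X_{m+1} by
-- replacing one of its 2m + 1 subterms t by t x_{m+2}; hence there are
-- 1 · 3 ⋯ (2m − 1) = (2m)! / (2^m m!) of them over X_{m+1}.

module Submission where

open import Defs
open import Data.Nat using (ℕ; zero; suc; _+_; _*_; _^_; _/_; _!; _≤_; _<_; _∸_; _⊓_; _⊔_; NonZero)
open import Data.Nat.Properties
open import Data.Nat.DivMod using (m*n/n≡m)
open import Data.Nat.Tactic.RingSolver using (solve-∀)
open import Data.Fin as Fin using (Fin; toℕ; inject₁; fromℕ; splitAt; _↑ˡ_; _↑ʳ_; combine; remQuot; cast)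
open import Data.Fin.Properties
  using (toℕ<n; toℕ-fromℕ; toℕ-inject₁; fromℕ≢inject₁; inject₁-injective; toℕ-injective;
         splitAt-↑ˡ; splitAt-↑ʳ; splitAt⁻¹-↑ˡ; splitAt⁻¹-↑ʳ; remQuot-combine; combine-remQuot; cast-involutive)
  renaming (_≟_ to _≟ᶠ_)
open import Data.Product using (Σ; _×_; _,_; proj₁; proj₂; uncurry)
open import Data.Sum using (_⊎_; inj₁; inj₂; [_,_]′)
open import Data.Unit using (⊤; tt)
open import Data.Empty using (⊥-elim)
open import Function using (_∘_)
open import Relation.Nullary using (yes; no; contradiction)
open import Relation.Binary using (tri<; tri≈; tri>)
import Relation.Binary.PropositionalEquality as ≡
open ≡ using (_≡_; _≢_; refl; sym; trans; cong; cong₂; subst₂)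

private
  variable
    n : ℕ

occ-var-self : (i : Fin n) → occ i (var i) ≡ 1
occ-var-self i with i ≟ᶠ i
... | yes _ = refl
... | no i≢i = contradiction refl i≢i

occ-var-≢ : {i j : Fin n} → i ≢ j → occ i (var j) ≡ 0
occ-var-≢ {i = i} {j} i≢j with i ≟ᶠ j
... | yes i≡j = contradiction i≡j i≢j
... | no _ = refl

m+n≡1-cases : ∀ m {k} → m + k ≡ 1 → (m ≡ 1 × k ≡ 0) ⊎ (m ≡ 0 × k ≡ 1)
m+n≡1-cases zero eq = inj₂ (refl , eq)
m+n≡1-cases (suc zero) eq = inj₁ (refl , suc-injective eq)
m+n≡1-cases (suc (suc _)) ()

cast-injective : {a b : ℕ} .(eq : a ≡ b) {i j : Fin a} → cast eq i ≡ cast eq j → i ≡ j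
cast-injective eq {i} {j} eq′ =
  trans (sym (cast-involutive (sym eq) eq i)) (trans (cong (cast (sym eq)) eq′) (cast-involutive (sym eq) eq j))

data InjectOrLast : Fin (suc n) → Set where
  inject : (i : Fin n) → InjectOrLast (inject₁ i)
  last : InjectOrLast (fromℕ n)

injectOrLast : (j : Fin (suc n)) → InjectOrLast j
injectOrLast {zero} Fin.zero = last
injectOrLast {suc n} Fin.zero = inject Fin.zero
injectOrLast {suc n} (Fin.suc j) with injectOrLast j
... | inject i = inject (Fin.suc i)
... | last = last

weaken : Term n → Term (suc n)
weaken (var i) = var (inject₁ i)
weaken (s · u) = weaken s · weaken u

var-injective : {i j : Fin n} → var i ≡ var j → i ≡ j
var-injective refl = refl

·-injective : {s u s′ u′ : Term n} → s · u ≡ s′ · u′ → s ≡ s′ × u ≡ u′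
·-injective refl = refl , refl

weaken-injective : {t t′ : Term n} → weaken t ≡ weaken t′ → t ≡ t′
weaken-injective {t = var i} {var j} eq = cong var (inject₁-injective (var-injective eq))
weaken-injective {t = s · u} {s′ · u′} eq =
  cong₂ _·_ (weaken-injective (proj₁ (·-injective eq))) (weaken-injective (proj₂ (·-injective eq)))

occ-weaken : (i : Fin n) (t : Term n) → occ (inject₁ i) (weaken t) ≡ occ i t
occ-weaken i (var j) with i ≟ᶠ j
... | yes refl = occ-var-self (inject₁ i)
... | no i≢j = occ-var-≢ (i≢j ∘ inject₁-injective)
occ-weaken i (s · u) = cong₂ _+_ (occ-weaken i s) (occ-weaken i u)

occ-last-weaken : (t : Term n) → occ (fromℕ n) (weaken t) ≡ 0
occ-last-weaken (var j) = occ-var-≢ fromℕ≢inject₁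
occ-last-weaken (s · u) = cong₂ _+_ (occ-last-weaken s) (occ-last-weaken u)

size : Term n → ℕ
size (var _) = 1
size (s · u) = suc (size s + size u)

size-weaken : (t : Term n) → size (weaken t) ≡ size t
size-weaken (var _) = refl
size-weaken (s · u) = cong suc (cong₂ _+_ (size-weaken s) (size-weaken u))

leftmost : Term n → Fin n
leftmost (var i) = i
leftmost (s · _) = leftmost s

key : Term n → ℕ
key = toℕ ∘ leftmost

occ-leftmost : (t : Term n) → 1 ≤ occ (leftmost t) t
occ-leftmost (var i) = ≤-reflexive (sym (occ-var-self i))
occ-leftmost (s · u) = ≤-trans (occ-leftmost s) (m≤m+n _ _)

key-weaken : (t : Term n) → key (weaken t) ≡ key t
key-weaken (var i) = toℕ-inject₁ i
key-weaken (s · _) = key-weaken s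

Sorted : Term n → Set
Sorted (var _) = ⊤
Sorted (s · u) = Sorted s × Sorted u × key s < key u

Sorted-weaken : (t : Term n) → Sorted t → Sorted (weaken t)
Sorted-weaken (var _) _ = tt
Sorted-weaken (s · u) (sorted-s , sorted-u , s<u) =
  Sorted-weaken s sorted-s , Sorted-weaken u sorted-u , subst₂ _<_ (sym (key-weaken s)) (sym (key-weaken u)) s<u

Sorted-weaken⁻ : (t : Term n) → Sorted (weaken t) → Sorted t
Sorted-weaken⁻ (var _) _ = tt
Sorted-weaken⁻ (s · u) (sorted-s , sorted-u , s<u) =
  Sorted-weaken⁻ s sorted-s , Sorted-weaken⁻ u sorted-u , subst₂ _<_ (key-weaken s) (key-weaken u) s<u

-- Grafting the last variable

data Pos {n} : Term n → Set where
  here  : {t : Term n} → Pos t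
  left  : {s u : Term n} → Pos s → Pos (s · u)
  right : {s u : Term n} → Pos u → Pos (s · u)

insert : (t : Term n) → Pos t → Term (suc n)
insert {n} t here = weaken t · var (fromℕ n)
insert (s · u) (left p) = insert s p · weaken u
insert (s · u) (right p) = weaken s · insert u p

occ-insert : (i : Fin n) (t : Term n) (p : Pos t) → occ (inject₁ i) (insert t p) ≡ occ i t
occ-insert i t here =
  trans (cong₂ _+_ (occ-weaken i t) (occ-var-≢ (fromℕ≢inject₁ ∘ sym))) (+-identityʳ _)
occ-insert i (s · u) (left p) = cong₂ _+_ (occ-insert i s p) (occ-weaken i u)
occ-insert i (s · u) (right p) = cong₂ _+_ (occ-weaken i s) (occ-insert i u p)

occ-last-insert : (t : Term n) (p : Pos t) → occ (fromℕ n) (insert t p) ≡ 1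
occ-last-insert {n} t here = cong₂ _+_ (occ-last-weaken t) (occ-var-self (fromℕ n))
occ-last-insert (s · u) (left p) = cong₂ _+_ (occ-last-insert s p) (occ-last-weaken u)
occ-last-insert (s · u) (right p) = cong₂ _+_ (occ-last-weaken s) (occ-last-insert u p)

FullLinear-insert : (t : Term n) (p : Pos t) → FullLinear t → FullLinear (insert t p)
FullLinear-insert t p linear j with injectOrLast j
... | inject i = trans (occ-insert i t p) (linear i)
... | last = occ-last-insert t p

FullLinear-insert⁻ : (t : Term n) (p : Pos t) → FullLinear (insert t p) → FullLinear t
FullLinear-insert⁻ t p linear i = trans (sym (occ-insert i t p)) (linear (inject₁ i))

size-insert : (t : Term n) (p : Pos t) → size (insert t p) ≡ 2 + size t
size-insert t here = cong suc (trans (cong (_+ 1) (size-weaken t)) (+-comm (size t) 1))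
size-insert (s · u) (left p) = cong suc (cong₂ _+_ (size-insert s p) (size-weaken u))
size-insert (s · u) (right p) =
  cong suc (trans (cong₂ _+_ (size-weaken s) (size-insert u p))
                  (trans (+-suc (size s) _) (cong suc (+-suc (size s) _))))

key-insert : (t : Term n) (p : Pos t) → key (insert t p) ≡ key t
key-insert t here = key-weaken t
key-insert (s · u) (left p) = key-insert s p
key-insert (s · u) (right p) = key-weaken s

Sorted-insert : (t : Term n) (p : Pos t) → Sorted t → Sorted (insert t p)
Sorted-insert {n} t here sorted =
  Sorted-weaken t sorted , tt , subst₂ _<_ (sym (key-weaken t)) (sym (toℕ-fromℕ n)) (toℕ<n (leftmost t))
Sorted-insert (s · u) (left p) (sorted-s , sorted-u , s<u) =
  Sorted-insert s p sorted-s , Sorted-weaken u sorted-u , subst₂ _<_ (sym (key-insert s p)) (sym (key-weaken u)) s<u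
Sorted-insert (s · u) (right p) (sorted-s , sorted-u , s<u) =
  Sorted-weaken s sorted-s , Sorted-insert u p sorted-u , subst₂ _<_ (sym (key-weaken s)) (sym (key-insert u p)) s<u

Sorted-insert⁻ : (t : Term n) (p : Pos t) → Sorted (insert t p) → Sorted t
Sorted-insert⁻ t here (sorted , _) = Sorted-weaken⁻ t sorted
Sorted-insert⁻ (s · u) (left p) (sorted-s , sorted-u , s<u) =
  Sorted-insert⁻ s p sorted-s , Sorted-weaken⁻ u sorted-u , subst₂ _<_ (key-insert s p) (key-weaken u) s<u
Sorted-insert⁻ (s · u) (right p) (sorted-s , sorted-u , s<u) =
  Sorted-weaken⁻ s sorted-s , Sorted-insert⁻ u p sorted-u , subst₂ _<_ (key-weaken s) (key-insert u p) s<u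

insert≢weaken : (t : Term n) (p : Pos t) (t′ : Term n) → insert t p ≢ weaken t′
insert≢weaken {n} t p t′ eq =
  0≢1+n (trans (sym (occ-last-weaken t′)) (trans (cong (occ (fromℕ n)) (sym eq)) (occ-last-insert t p)))

insert≢var : (t : Term n) (p : Pos t) (j : Fin (suc n)) → insert t p ≢ var j
insert≢var t here j ()
insert≢var (s · u) (left p) j ()
insert≢var (s · u) (right p) j ()

weaken≢last : (t : Term n) → weaken t ≢ var (fromℕ n)
weaken≢last (var i) eq = fromℕ≢inject₁ (sym (var-injective eq))

insert-injective : {t t′ : Term n} {p : Pos t} {p′ : Pos t′} →
                   insert t p ≡ insert t′ p′ → (t , p) ≡ (t′ , p′)
insert-injective {p = here} {here} eq with weaken-injective (proj₁ (·-injective eq))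
... | refl = refl
insert-injective {t′ = _ · u′} {p = here} {left _} eq =
  ⊥-elim (weaken≢last u′ (sym (proj₂ (·-injective eq))))
insert-injective {t′ = _ · u′} {p = here} {right p′} eq =
  ⊥-elim (insert≢var u′ p′ _ (sym (proj₂ (·-injective eq))))
insert-injective {t = _ · u} {p = left _} {here} eq =
  ⊥-elim (weaken≢last u (proj₂ (·-injective eq)))
insert-injective {p = left _} {left _} eq
  with insert-injective (proj₁ (·-injective eq)) | weaken-injective (proj₂ (·-injective eq))
... | refl | refl = refl
insert-injective {t = s · _} {s′ · _} {left p} {right _} eq =
  ⊥-elim (insert≢weaken s p s′ (proj₁ (·-injective eq)))
insert-injective {t = _ · u} {p = right p} {here} eq =
  ⊥-elim (insert≢var u p _ (proj₂ (·-injective eq)))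
insert-injective {t = s · _} {s′ · _} {right _} {left p′} eq =
  ⊥-elim (insert≢weaken s′ p′ s (sym (proj₁ (·-injective eq))))
insert-injective {p = right _} {right _} eq
  with weaken-injective (proj₁ (·-injective eq)) | insert-injective (proj₂ (·-injective eq))
... | refl | refl = refl

insert-injectiveʳ : {t : Term n} {p p′ : Pos t} → insert t p ≡ insert t p′ → p ≡ p′
insert-injectiveʳ eq with insert-injective eq
... | refl = refl

data Weakened {n} : Term (suc n) → Set where
  weakened : (t : Term n) → Weakened (weaken t)

strengthen : (t : Term (suc n)) → occ (fromℕ n) t ≡ 0 → Weakened t
strengthen (var j) absent with injectOrLast j
... | inject i = weakened (var i)
... | last = contradiction (trans (sym (occ-var-self _)) absent) λ ()
strengthen (s · u) absent
  with strengthen s (m+n≡0⇒m≡0 _ absent) | strengthen u (m+n≡0⇒n≡0 _ absent)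
... | weakened s′ | weakened u′ = weakened (s′ · u′)

data InsertionView {n} : Term (suc n) → Set where
  lastVar  : InsertionView (var (fromℕ n))
  inserted : (t : Term n) (p : Pos t) → InsertionView (insert t p)

-- The last variable has the largest index, so in a sorted term it is never a left factor.
insertionView : (t : Term (suc n)) → Sorted t → occ (fromℕ n) t ≡ 1 → InsertionView t
insertionView (var j) _ once with injectOrLast j
... | inject i = contradiction (trans (sym (occ-var-≢ fromℕ≢inject₁)) once) λ ()
... | last = lastVar
insertionView {n} (s · u) (sorted-s , sorted-u , s<u) once with m+n≡1-cases (occ (fromℕ n) s) once
... | inj₂ (absent , present) with strengthen s absent | insertionView u sorted-u present
...   | weakened s′ | lastVar = inserted s′ here
...   | weakened s′ | inserted u′ p = inserted (s′ · u′) (right p)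
insertionView {n} (s · u) (sorted-s , sorted-u , s<u) once
    | inj₁ (present , absent) with insertionView s sorted-s present | strengthen u absent
...   | inserted s′ p | weakened u′ = inserted (s′ · u′) (left p)
...   | lastVar | weakened u′ =
  ⊥-elim (<-asym (toℕ<n (leftmost u′)) (subst₂ _<_ (toℕ-fromℕ n) (key-weaken u′) s<u))

index : {t : Term n} → Pos t → Fin (size t)
index {t = var _} here = Fin.zero
index {t = _ · _} here = Fin.zero
index {t = _ · u} (left p) = Fin.suc (index p ↑ˡ size u)
index {t = s · _} (right p) = Fin.suc (size s ↑ʳ index p)

position : (t : Term n) → Fin (size t) → Pos t
position (var _) Fin.zero = here
position (s · u) Fin.zero = here
position (s · u) (Fin.suc i) = [ left ∘ position s , right ∘ position u ]′ (splitAt (size s) i)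

position-index : (t : Term n) (p : Pos t) → position t (index p) ≡ p
position-index (var _) here = refl
position-index (_ · _) here = refl
position-index (s · u) (left p)
  rewrite splitAt-↑ˡ (size s) (index p) (size u) = cong left (position-index s p)
position-index (s · u) (right p)
  rewrite splitAt-↑ʳ (size s) (size u) (index p) = cong right (position-index u p)

index-position : (t : Term n) (i : Fin (size t)) → index (position t i) ≡ i
index-position (var _) Fin.zero = refl
index-position (_ · _) Fin.zero = refl
index-position (s · u) (Fin.suc i) with splitAt (size s) i in split
... | inj₁ j = cong Fin.suc (trans (cong (_↑ˡ size u) (index-position s j)) (splitAt⁻¹-↑ˡ split))
... | inj₂ j = cong Fin.suc (trans (cong (size s ↑ʳ_) (index-position u j)) (splitAt⁻¹-↑ʳ split))

position-injective : (t : Term n) {i j : Fin (size t)} → position t i ≡ position t j → i ≡ j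
position-injective t {i} {j} eq =
  trans (sym (index-position t i)) (trans (cong index eq) (index-position t j))

-- Enumerating the sorted full linear terms

oddFactorial : ℕ → ℕ
oddFactorial zero = 1
oddFactorial (suc m) = oddFactorial m * suc (2 * m)

mutual
  enumerate : (m : ℕ) → Fin (oddFactorial m) → Term (suc m)
  enumerate zero _ = var Fin.zero
  enumerate (suc m) k = extend m (remQuot (suc (2 * m)) k)

  extend : (m : ℕ) → Fin (oddFactorial m) × Fin (suc (2 * m)) → Term (suc (suc m))
  extend m (q , r) = insert (enumerate m q) (slot m q r)

  slot : (m : ℕ) (q : Fin (oddFactorial m)) → Fin (suc (2 * m)) → Pos (enumerate m q)
  slot m q r = position (enumerate m q) (cast (sym (size-enumerate m q)) r)

  size-enumerate : (m : ℕ) (k : Fin (oddFactorial m)) → size (enumerate m k) ≡ suc (2 * m)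
  size-enumerate zero _ = refl
  size-enumerate (suc m) k = size-extend m (remQuot (suc (2 * m)) k)

  size-extend : (m : ℕ) (x : Fin (oddFactorial m) × Fin (suc (2 * m))) → size (extend m x) ≡ suc (2 * suc m)
  size-extend m (q , r) = trans (size-insert (enumerate m q) _)
                                (trans (cong (2 +_) (size-enumerate m q)) (cong suc (sym (*-suc 2 m))))

enumerate-sorted : (m : ℕ) (k : Fin (oddFactorial m)) → Sorted (enumerate m k)
enumerate-sorted zero _ = tt
enumerate-sorted (suc m) k =
  let (q , r) = remQuot (suc (2 * m)) k in Sorted-insert (enumerate m q) (slot m q r) (enumerate-sorted m q)

enumerate-fullLinear : (m : ℕ) (k : Fin (oddFactorial m)) → FullLinear (enumerate m k)
enumerate-fullLinear zero _ Fin.zero = occ-var-self {1} Fin.zero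
enumerate-fullLinear (suc m) k =
  let (q , r) = remQuot (suc (2 * m)) k in FullLinear-insert (enumerate m q) (slot m q r) (enumerate-fullLinear m q)

mutual
  enumerate-injective : (m : ℕ) {k k′ : Fin (oddFactorial m)} → enumerate m k ≡ enumerate m k′ → k ≡ k′
  enumerate-injective zero {Fin.zero} {Fin.zero} _ = refl
  enumerate-injective (suc m) {k} {k′} eq =
    trans (sym (combine-remQuot {oddFactorial m} _ k))
          (trans (cong (uncurry combine) (extend-injective m eq)) (combine-remQuot {oddFactorial m} _ k′))

  extend-injective : (m : ℕ) {x y : Fin (oddFactorial m) × Fin (suc (2 * m))} → extend m x ≡ extend m y → x ≡ y
  extend-injective m {q , r} {q′ , r′} eq with enumerate-injective m (cong proj₁ (insert-injective eq))
  ... | refl = cong (q ,_) (cast-injective _ (position-injective (enumerate m q) (insert-injectiveʳ eq)))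

1≤occ-Term₁ : (t : Term 1) → 1 ≤ occ Fin.zero t
1≤occ-Term₁ t with leftmost t | occ-leftmost t
... | Fin.zero | present = present

slot-index : (m : ℕ) (q : Fin (oddFactorial m)) (p : Pos (enumerate m q)) →
             slot m q (cast (size-enumerate m q) (index p)) ≡ p
slot-index m q p =
  trans (cong (position t) (cast-involutive (sym (size-enumerate m q)) (size-enumerate m q) (index p)))
        (position-index t p)
  where t = enumerate m q

enumerate-combine : (m : ℕ) (q : Fin (oddFactorial m)) (r : Fin (suc (2 * m))) →
                    enumerate (suc m) (combine q r) ≡ insert (enumerate m q) (slot m q r)
enumerate-combine m q r = cong (extend m) (remQuot-combine q r)

enumerate-surjective : (m : ℕ) (t : Term (suc m)) → Sorted t → FullLinear t →
                       Σ (Fin (oddFactorial m)) λ k → enumerate m k ≡ t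
enumerate-surjective zero (var Fin.zero) _ _ = Fin.zero , refl
enumerate-surjective zero (s · u) _ linear =
  contradiction (≤-trans (+-mono-≤ (1≤occ-Term₁ s) (1≤occ-Term₁ u)) (≤-reflexive (linear Fin.zero)))
                (<-irrefl refl)
enumerate-surjective (suc m) t sorted linear with insertionView t sorted (linear (fromℕ (suc m)))
... | lastVar = contradiction (linear Fin.zero) λ ()
... | inserted t′ p
  with enumerate-surjective m t′ (Sorted-insert⁻ t′ p sorted) (FullLinear-insert⁻ t′ p linear)
...   | q , refl =
  let r = cast (size-enumerate m q) (index p) in
  combine q r , trans (enumerate-combine m q r) (cong (insert (enumerate m q)) (slot-index m q p))

-- Sorting products

orient : Term n → Term n → Term n
orient s u with key s <? key u
... | yes _ = s · u
... | no _ = u · s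

normalize : Term n → Term n
normalize (var i) = var i
normalize (s · u) = orient (normalize s) (normalize u)

module _ {G : Set} (_∙_ : G → G → G) (∙-comm : ∀ a b → a ∙ b ≡ b ∙ a) (w : Fin n → G) where

  eval-orient : (s u : Term n) → eval _∙_ w (orient s u) ≡ eval _∙_ w s ∙ eval _∙_ w u
  eval-orient s u with key s <? key u
  ... | yes _ = refl
  ... | no _ = ∙-comm _ _

  eval-normalize : (t : Term n) → eval _∙_ w (normalize t) ≡ eval _∙_ w t
  eval-normalize (var i) = refl
  eval-normalize (s · u) =
    trans (eval-orient (normalize s) (normalize u)) (cong₂ _∙_ (eval-normalize s) (eval-normalize u))

occ-orient : (i : Fin n) (s u : Term n) → occ i (orient s u) ≡ occ i s + occ i u
occ-orient i s u with key s <? key u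
... | yes _ = refl
... | no _ = +-comm (occ i u) (occ i s)

occ-normalize : (i : Fin n) (t : Term n) → occ i (normalize t) ≡ occ i t
occ-normalize i (var j) = refl
occ-normalize i (s · u) =
  trans (occ-orient i (normalize s) (normalize u)) (cong₂ _+_ (occ-normalize i s) (occ-normalize i u))

Linear : Term n → Set
Linear {n} t = (i : Fin n) → occ i t ≤ 1

Sorted-orient : (s u : Term n) → Sorted s → Sorted u → key s ≢ key u → Sorted (orient s u)
Sorted-orient s u sorted-s sorted-u s≢u with key s <? key u
... | yes s<u = sorted-s , sorted-u , s<u
... | no s≮u = sorted-u , sorted-s , ≤∧≢⇒< (≮⇒≥ s≮u) (s≢u ∘ sym)

Sorted-normalize : (t : Term n) → Linear t → Sorted (normalize t)
Sorted-normalize (var i) _ = tt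
Sorted-normalize (s · u) linear =
  Sorted-orient (normalize s) (normalize u) (Sorted-normalize s linear-s) (Sorted-normalize u linear-u) keys-differ
  where
  linear-s : Linear s
  linear-s i = ≤-trans (m≤m+n _ _) (linear i)
  linear-u : Linear u
  linear-u i = ≤-trans (m≤n+m _ _) (linear i)
  keys-differ : key (normalize s) ≢ key (normalize u)
  keys-differ same = contradiction (≤-trans (+-mono-≤ in-s in-u) (linear i)) (<-irrefl refl)
    where
    i = leftmost (normalize s)
    in-s : 1 ≤ occ i s
    in-s = ≡.subst (1 ≤_) (occ-normalize i s) (occ-leftmost (normalize s))
    in-u : 1 ≤ occ i u
    in-u = ≡.subst (λ j → 1 ≤ occ j u) (sym (toℕ-injective same))
                   (≡.subst (1 ≤_) (occ-normalize _ u) (occ-leftmost (normalize u)))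

FullLinear-normalize : (t : Term n) → FullLinear t → FullLinear (normalize t)
FullLinear-normalize t linear i = trans (occ-normalize i t) (linear i)

eval-subst : {G : Set} (_∙_ : G → G → G) (w : Fin 1 → G) (a : Fin n → Term 1) (t : Term n) →
             eval _∙_ w (subst t a) ≡ eval _∙_ (λ i → eval _∙_ w (a i)) t
eval-subst _∙_ w a (var i) = refl
eval-subst _∙_ w a (s · u) = cong₂ _∙_ (eval-subst _∙_ w a s) (eval-subst _∙_ w a u)

SameOpF-normalize : (t : Term n) → SameOpF t (normalize t)
SameOpF-normalize t a G _∙_ ∙-comm w =
  trans (eval-subst _∙_ w a t)
        (trans (sym (eval-normalize _∙_ ∙-comm (λ i → eval _∙_ w (a i)) t))
               (sym (eval-subst _∙_ w a (normalize t))))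

-- A commutative groupoid on ℕ separating sorted terms

square+-< : ∀ {x y y′} x′ → x ≤ y → y < y′ → y * y + x < y′ * y′ + x′
square+-< {x} {y} {y′} x′ x≤y y<y′ = begin-strict
  y * y + x             ≤⟨ +-monoʳ-≤ (y * y) x≤y ⟩
  y * y + y             <⟨ +-monoʳ-< (y * y) (n<1+n y) ⟩
  y * y + suc y         ≡⟨ +-comm (y * y) (suc y) ⟩
  suc y + y * y         ≤⟨ +-monoʳ-≤ (suc y) (*-monoʳ-≤ y (n≤1+n y)) ⟩
  suc y * suc y         ≤⟨ *-mono-≤ y<y′ y<y′ ⟩
  y′ * y′               ≤⟨ m≤m+n (y′ * y′) x′ ⟩
  y′ * y′ + x′          ∎
  where open ≤-Reasoning

square+-injective : ∀ {x y x′ y′} → x ≤ y → x′ ≤ y′ → y * y + x ≡ y′ * y′ + x′ → x ≡ x′ × y ≡ y′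
square+-injective {x} {y} {x′} {y′} x≤y x′≤y′ eq with <-cmp y y′
... | tri< y<y′ _ _ = contradiction eq (<⇒≢ (square+-< x′ x≤y y<y′))
... | tri≈ _ refl _ = +-cancelˡ-≡ (y * y) x x′ eq , refl
... | tri> _ _ y′<y = contradiction (sym eq) (<⇒≢ (square+-< x x′≤y′ y′<y))

⊓-⊔-cases : ∀ a b → (a ⊓ b ≡ a × a ⊔ b ≡ b) ⊎ (a ⊓ b ≡ b × a ⊔ b ≡ a)
⊓-⊔-cases a b with ≤-total a b
... | inj₁ a≤b = inj₁ (m≤n⇒m⊓n≡m a≤b , m≤n⇒m⊔n≡n a≤b)
... | inj₂ b≤a = inj₂ (m≥n⇒m⊓n≡n b≤a , m≥n⇒m⊔n≡m b≤a)

⊓-⊔-injective : ∀ {a b c d} → a ⊓ b ≡ c ⊓ d → a ⊔ b ≡ c ⊔ d → (a ≡ c × b ≡ d) ⊎ (a ≡ d × b ≡ c)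
⊓-⊔-injective {a} {b} {c} {d} min max with ⊓-⊔-cases a b | ⊓-⊔-cases c d
... | inj₁ (p , q) | inj₁ (p′ , q′) = inj₁ (trans (sym p) (trans min p′) , trans (sym q) (trans max q′))
... | inj₁ (p , q) | inj₂ (p′ , q′) = inj₂ (trans (sym p) (trans min p′) , trans (sym q) (trans max q′))
... | inj₂ (p , q) | inj₁ (p′ , q′) = inj₂ (trans (sym q) (trans max q′) , trans (sym p) (trans min p′))
... | inj₂ (p , q) | inj₂ (p′ , q′) = inj₁ (trans (sym q) (trans max q′) , trans (sym p) (trans min p′))

infixl 7 _◇_

_◇_ : ℕ → ℕ → ℕ
a ◇ b = suc ((a ⊔ b) * (a ⊔ b) + a ⊓ b)

◇-comm : ∀ a b → a ◇ b ≡ b ◇ a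
◇-comm a b = cong₂ (λ x y → suc (x * x + y)) (⊔-comm a b) (⊓-comm a b)

◇-injective : ∀ a b c d → a ◇ b ≡ c ◇ d → (a ≡ c × b ≡ d) ⊎ (a ≡ d × b ≡ c)
◇-injective a b c d eq =
  let (min , max) = square+-injective (m⊓n≤m⊔n a b) (m⊓n≤m⊔n c d) (suc-injective eq) in ⊓-⊔-injective min max

leftPower : ℕ → Term 1
leftPower zero = var Fin.zero · var Fin.zero
leftPower (suc k) = leftPower k · var Fin.zero

atom : ℕ → ℕ
atom k = eval _◇_ (λ _ → 0) (leftPower k)

atom≢0 : ∀ k → atom k ≢ 0
atom≢0 zero ()
atom≢0 (suc k) ()

atom-injective : ∀ {i j} → atom i ≡ atom j → i ≡ j
atom-injective {zero} {zero} _ = refl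
atom-injective {zero} {suc j} eq with ◇-injective 0 0 (atom j) 0 eq
... | inj₁ (0≡atom , _) = contradiction (sym 0≡atom) (atom≢0 j)
... | inj₂ (_ , 0≡atom) = contradiction (sym 0≡atom) (atom≢0 j)
atom-injective {suc i} {zero} eq with ◇-injective (atom i) 0 0 0 eq
... | inj₁ (atom≡0 , _) = contradiction atom≡0 (atom≢0 i)
... | inj₂ (atom≡0 , _) = contradiction atom≡0 (atom≢0 i)
atom-injective {suc i} {suc j} eq with ◇-injective (atom i) 0 (atom j) 0 eq
... | inj₁ (atom≡atom , _) = cong suc (atom-injective atom≡atom)
... | inj₂ (atom≡0 , _) = contradiction atom≡0 (atom≢0 i)

atom≢◇ : ∀ k {a b} → a ≢ 0 → b ≢ 0 → atom k ≢ a ◇ b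
atom≢◇ zero {a} {b} a≢0 b≢0 eq with ◇-injective 0 0 a b eq
... | inj₁ (0≡a , _) = a≢0 (sym 0≡a)
... | inj₂ (0≡b , _) = b≢0 (sym 0≡b)
atom≢◇ (suc k) {a} {b} a≢0 b≢0 eq with ◇-injective (atom k) 0 a b eq
... | inj₁ (_ , 0≡b) = b≢0 (sym 0≡b)
... | inj₂ (_ , 0≡a) = a≢0 (sym 0≡a)

-- The effect of substituting x₁^(i+2) ∈ F for the variable i and then evaluating at x₁ ↦ 0.
⟦_⟧ : Term n → ℕ
⟦ t ⟧ = eval _◇_ (λ i → atom (toℕ i)) t

⟦⟧≢0 : (t : Term n) → ⟦ t ⟧ ≢ 0
⟦⟧≢0 (var i) = atom≢0 (toℕ i)
⟦⟧≢0 (s · u) ()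

⟦⟧-injective : (t t′ : Term n) → Sorted t → Sorted t′ → ⟦ t ⟧ ≡ ⟦ t′ ⟧ → t ≡ t′
⟦⟧-injective (var i) (var j) _ _ eq = cong var (toℕ-injective (atom-injective eq))
⟦⟧-injective (var i) (s · u) _ _ eq = ⊥-elim (atom≢◇ (toℕ i) (⟦⟧≢0 s) (⟦⟧≢0 u) eq)
⟦⟧-injective (s · u) (var i) _ _ eq = ⊥-elim (atom≢◇ (toℕ i) (⟦⟧≢0 s) (⟦⟧≢0 u) (sym eq))
⟦⟧-injective (s · u) (s′ · u′) (sorted-s , sorted-u , s<u) (sorted-s′ , sorted-u′ , s′<u′) eq
  with ◇-injective ⟦ s ⟧ ⟦ u ⟧ ⟦ s′ ⟧ ⟦ u′ ⟧ eq
... | inj₁ (s≈s′ , u≈u′) =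
  cong₂ _·_ (⟦⟧-injective s s′ sorted-s sorted-s′ s≈s′) (⟦⟧-injective u u′ sorted-u sorted-u′ u≈u′)
... | inj₂ (s≈u′ , u≈s′)
  with ⟦⟧-injective s u′ sorted-s sorted-u′ s≈u′ | ⟦⟧-injective u s′ sorted-u sorted-s′ u≈s′
...   | refl | refl = ⊥-elim (<-asym s<u s′<u′)

SameOpF⇒⟦⟧≡ : (t t′ : Term n) → SameOpF t t′ → ⟦ t ⟧ ≡ ⟦ t′ ⟧
SameOpF⇒⟦⟧≡ t t′ same =
  trans (sym (eval-subst _◇_ generator powers t))
        (trans (same powers ℕ _◇_ ◇-comm generator) (eval-subst _◇_ generator powers t′))
  where
  generator : Fin 1 → ℕ
  generator _ = 0
  powers : Fin _ → Term 1
  powers i = leftPower (toℕ i)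

oddFactorial-*-2^*! : ∀ m → (2 * m) ! ≡ oddFactorial m * (2 ^ m * m !)
oddFactorial-*-2^*! zero = refl
oddFactorial-*-2^*! (suc m) = begin
  (2 * suc m) !
    ≡⟨ cong _! (*-suc 2 m) ⟩
  (2 + 2 * m) * ((1 + 2 * m) * (2 * m) !)
    ≡⟨ cong (λ x → (2 + 2 * m) * ((1 + 2 * m) * x)) (oddFactorial-*-2^*! m) ⟩
  (2 + 2 * m) * ((1 + 2 * m) * (oddFactorial m * (2 ^ m * m !)))
    ≡⟨ rearrange m (oddFactorial m) (2 ^ m) (m !) ⟩
  oddFactorial m * (1 + 2 * m) * (2 * 2 ^ m * ((1 + m) * m !))
    ∎
  where
  open ≡.≡-Reasoning
  rearrange : ∀ m t p f → (2 + 2 * m) * ((1 + 2 * m) * (t * (p * f))) ≡ t * (1 + 2 * m) * (2 * p * ((1 + m) * f))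
  rearrange = solve-∀

oddFactorial≡D : ∀ m → oddFactorial m ≡ D m
oddFactorial≡D m =
  sym (trans (cong (_/ (2 ^ m * m !)) (oddFactorial-*-2^*! m)) (m*n/n≡m (oddFactorial m) (2 ^ m * m !)))
  where
  instance
    _ : NonZero (2 ^ m * m !)
    _ = m*n≢0 (2 ^ m) (m !) {{m^n≢0 2 m}} {{m !≢0}}

proposition3p6 : (n : ℕ) → 1 ≤ n → AcSpectrumF n (D (n ∸ 1))
proposition3p6 (suc m) _ =
  ≡.subst (AcSpectrumF (suc m)) (oddFactorial≡D m) (enumerate m , enumerate-fullLinear m , distinct , complete)
  where
  distinct : (i j : Fin (oddFactorial m)) → SameOpF (enumerate m i) (enumerate m j) → i ≡ j
  distinct i j same =
    enumerate-injective m (⟦⟧-injective (enumerate m i) (enumerate m j) (enumerate-sorted m i) (enumerate-sorted m j)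
                                        (SameOpF⇒⟦⟧≡ (enumerate m i) (enumerate m j) same))
  complete : (t : Term (suc m)) → FullLinear t → Σ (Fin (oddFactorial m)) λ k → SameOpF t (enumerate m k)
  complete t linear =
    let (k , normal≡) = enumerate-surjective m (normalize t) (Sorted-normalize t (≤-reflexive ∘ linear))
                                            (FullLinear-normalize t linear)
    in k , ≡.subst (SameOpF t) (sym normal≡) (SameOpF-normalize t)
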